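{- Let $\mathcal{P}$ be a set of $r$-patterns, $M$ an ordered $r$-matching, and $N\subseteq M$ a sub-matching which is a $\mathcal{P}$-clique. Let $\mathcal{Q}\subset\mathcal{P}$ and $\mathcal{Q}^c=\mathcal{P}\setminus\mathcal{Q}$. Suppose that $\prec$ is a partial order on $N$ such that for all $e,f\in N$ we have $e\prec f$ if and only if $\min e<\min f$ and $e,f$ form an $r$-pattern from $\mathcal{Q}$. Then $z_{\mathcal{Q}^c}(M)\ge |N|/z_{\mathcal{Q}}(M)$.
   Context: An ordered $r$-matching is a set of pairwise disjoint $r$-element subsets (edges) of a linearly ordered vertex set (every vertex lies in an edge). Two ordered hypergraphs are order-isomorphic if there is an order-preserving isomorphism. An $r$-pattern is an ordered $r$-matching of size 2 (up to order-isomorphism); two edges form pattern $P$ if the sub-matching they constitute is order-isomorphic to $P$. For a set $\mathcal{P}$ of $r$-patterns, a $\mathcal{P}$-clique is an ordered $r$-matching in which every pair of edges forms a member of $\mathcal{P}$; $z_{\mathcal{P}}(M)$ is the maximum size of a $\mathcal{P}$-clique that is a sub-matching of $M$. -}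

module Defs where

open import Data.Bool using (Bool; true; false; if_then_else_; not)
open import Data.Nat using (ℕ; zero; suc; _<_; _≤_; _<ᵇ_; _*_)
open import Data.List using (List; []; _∷_; map; length)
open import Data.Product using (Σ; _×_; ∃-syntax)
open import Relation.Nullary using (¬_)
open import Relation.Binary.PropositionalEquality using (_≡_)
open import Data.List.Relation.Unary.All using (All)
open import Data.List.Relation.Unary.AllPairs using (AllPairs)
open import Data.List.Relation.Unary.Linked using (Linked)
open import Data.List.Relation.Binary.Disjoint.Propositional using (Disjoint)
open import Data.List.Relation.Binary.Sublist.Propositional using (_⊆_)
open import Data.List.Membership.Propositional using (_∈_)

-- Vertices are natural numbers with their usual order (any finite linearly
-- ordered vertex set is order-isomorphic to a subset of ℕ).
-- An edge is a strictly increasing list of vertices.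
Edge : Set
Edge = List ℕ

IsEdge : ℕ → Edge → Set
IsEdge r e = Linked _<_ e × length e ≡ r

IsMatching : ℕ → List Edge → Set
IsMatching r M = All (IsEdge r) M × AllPairs Disjoint M

SubMatching : List Edge → List Edge → Set
SubMatching N M = N ⊆ M

-- Minimum vertex of an edge (edges are sorted and non-empty when r ≥ 1).
minE : Edge → ℕ
minE []      = 0
minE (x ∷ _) = x

lab : List ℕ → List ℕ → List Bool
lab []       ys       = map (λ _ → false) ys
lab (x ∷ xs) []       = true ∷ lab xs []
lab (x ∷ xs) (y ∷ ys) =
  if x <ᵇ y then true ∷ lab xs (y ∷ ys) else false ∷ lab (x ∷ xs) ys

-- An r-pattern (order-isomorphism class of a 2-edge ordered r-matching) is
-- represented canonically by a word in Bool of length 2r: position i is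
-- true iff the i-th smallest vertex lies in the edge containing the
-- overall minimum vertex.
Pattern : Set
Pattern = List Bool

normalise : List Bool → List Bool
normalise []           = []
normalise (true ∷ w)   = true ∷ w
normalise (false ∷ w)  = map not (false ∷ w)

pat : Edge → Edge → Pattern
pat e f = normalise (lab e f)

PatternSet : Set₁
PatternSet = Pattern → Set

_⊆ₚ_ : PatternSet → PatternSet → Set
Q ⊆ₚ P = ∀ w → Q w → P w

_∖ₚ_ : PatternSet → PatternSet → PatternSet
(P ∖ₚ Q) w = P w × ¬ Q w

Forms : PatternSet → Edge → Edge → Set
Forms P e f = P (pat e f)

IsClique : PatternSet → List Edge → Set
IsClique P C = AllPairs (Forms P) C

IsZ : PatternSet → List Edge → ℕ → Set
IsZ P M k =
  (∃[ C ] (SubMatching C M × IsClique P C × length C ≡ k)) ×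
  (∀ C → SubMatching C M → IsClique P C → length C ≤ k)

IsStrictPartialOrderOn : (Edge → Edge → Set) → List Edge → Set
IsStrictPartialOrderOn _≺_ N =
  (∀ {e} → e ∈ N → ¬ (e ≺ e)) ×
  (∀ {e f g} → e ∈ N → f ∈ N → g ∈ N → e ≺ f → f ≺ g → e ≺ g)

-- Two comparable edges form a
-- pattern of 𝒬 (patterns do not depend on the order of the two edges), and two
-- incomparable edges of the 𝒫-clique N form a pattern of 𝒫 ∖ 𝒬 (their minima
-- differ since they are disjoint). So chains are 𝒬-cliques and antichains are
-- (𝒫 ∖ 𝒬)-cliques, and the dual of Dilworth's theorem (Mirsky: peel off the
-- maximal elements, an antichain, at most height-many times) bounds |N| by
-- z_𝒬(M) · z_{𝒬ᶜ}(M).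

module Submission where

open import Defs
open import Data.Nat using (ℕ; _<_; _≤_; _*_; NonZero)
open import Data.List using (List; length)
open import Data.Product using (_×_)
open import Function.Bundles using (_⇔_)
open import Data.List.Membership.Propositional using (_∈_)

open import Data.Bool using (true; false; not)
open import Data.Bool.Properties using (not-involutive)
open import Data.Nat using (zero; suc; _+_; _<ᵇ_; _≤?_; _≟_; z≤n; s≤s⁻¹; ≢-nonZero⁻¹)
open import Data.Nat.Properties
  using (<ᵇ-reflects-<; <-asym; <-cmp; +-suc; +-mono-≤; <⇒≱; *-comm; module ≤-Reasoning)
open import Data.List using ([]; _∷_; map; filter)
open import Data.List.Properties using (map-∘; map-id; map-cong; ≡-dec)
open import Data.List.Extrema.Nat using (argmax; argmax-all; f[xs]≤f[argmax])
open import Data.List.Membership.Propositional using (_∉_; find; lose)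
open import Data.List.Membership.Propositional.Properties using (∈-filter⁺; ∈-filter⁻)
open import Data.List.Membership.DecPropositional (≡-dec _≟_) using (_∈?_)
open import Data.List.Relation.Unary.All as All using (All; []; _∷_)
open import Data.List.Relation.Unary.All.Properties using (all-filter)
open import Data.List.Relation.Unary.Any using (Any; here; there; any?)
open import Data.List.Relation.Unary.AllPairs as AllPairs using (AllPairs; []; _∷_)
open import Data.List.Relation.Binary.Disjoint.Propositional using (Disjoint)
open import Data.List.Relation.Binary.Sublist.Propositional
  using (_⊆_; _⊇_; []; _∷_; _∷ʳ_; ⊆-trans; lookup; minimum)
open import Data.List.Relation.Binary.Sublist.Propositional.Properties using (filter-⊆; All-resp-⊆)
open import Data.List.Relation.Binary.Permutation.Propositional
  using (_↭_; ↭-refl; ↭-prep; ↭-swap; ↭-trans; ↭-sym; ↭⇒↭ₛ)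
open import Data.List.Relation.Binary.Permutation.Propositional.Properties using (↭-length)
open import Data.Product using (∃-syntax; _,_; proj₁; proj₂; map₁; map₂)
open import Data.Sum as Sum using (_⊎_; inj₁; inj₂)
open import Function using (_∘_; _on_; const)
open import Function.Bundles using (module Equivalence)
open import Level using (Level; 0ℓ)
open import Relation.Binary using (Rel; Decidable; Transitive; _⇒_; _Respects_; tri<; tri≈; tri>)
open import Relation.Binary.Construct.Closure.Reflexive using (ReflClosure; refl; [_])
open import Relation.Binary.PropositionalEquality using (_≡_; refl; sym; trans; cong; subst; setoid; resp₂)
open import Relation.Nullary
  using (¬_; Dec; yes; no; ofʸ; ofⁿ; contradiction; ¬¬-map; ¬¬-excluded-middle; decidable-stable)
open import Relation.Nullary.Negation using (¬¬-Monad)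
open import Relation.Unary using (Pred) renaming (Decidable to Decidableᵘ)
open import Relation.Unary.Properties using (∁?)

lab-[]ʳ : ∀ xs → lab xs [] ≡ map (const true) xs
lab-[]ʳ []       = refl
lab-[]ʳ (x ∷ xs) = cong (true ∷_) (lab-[]ʳ xs)

lab-swap : ∀ xs ys → Disjoint xs ys → lab ys xs ≡ map not (lab xs ys)
lab-swap []       ys       _ = trans (lab-[]ʳ ys) (map-∘ ys)
lab-swap (x ∷ xs) []       _ = cong (false ∷_) (trans (map-∘ xs) (cong (map not) (sym (lab-[]ʳ xs))))
lab-swap (x ∷ xs) (y ∷ ys) d =
  swap-heads (lab-swap xs (y ∷ ys) (d ∘ map₁ there)) (lab-swap (x ∷ xs) ys (d ∘ map₂ there))
  where
  swap-heads : lab (y ∷ ys) xs ≡ map not (lab xs (y ∷ ys)) →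
               lab ys (x ∷ xs) ≡ map not (lab (x ∷ xs) ys) →
               lab (y ∷ ys) (x ∷ xs) ≡ map not (lab (x ∷ xs) (y ∷ ys))
  swap-heads ih₁ ih₂ with x <ᵇ y | <ᵇ-reflects-< x y | y <ᵇ x | <ᵇ-reflects-< y x
  ... | true  | ofʸ x<y | true  | ofʸ y<x = contradiction y<x (<-asym x<y)
  ... | true  | _       | false | _       = cong (false ∷_) ih₁
  ... | false | _       | true  | _       = cong (true ∷_) ih₂
  ... | false | ofⁿ x≮y | false | ofⁿ y≮x with <-cmp x y
  ...   | tri< x<y _ _ = contradiction x<y x≮y
  ...   | tri≈ _ x≡y _ = contradiction (here refl , here x≡y) d
  ...   | tri> _ _ y<x = contradiction y<x y≮x

normalise-map-not : ∀ w → normalise (map not w) ≡ normalise w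
normalise-map-not []          = refl
normalise-map-not (false ∷ w) = refl
normalise-map-not (true ∷ w)  =
  cong (true ∷_) (trans (sym (map-∘ w)) (trans (map-cong not-involutive w) (map-id w)))

pat-swap : ∀ {e f} → Disjoint e f → pat f e ≡ pat e f
pat-swap {e} {f} d = trans (cong normalise (lab-swap e f d)) (normalise-map-not (lab e f))

private
  variable
    p r : Level

module _ {A : Set} where

  All⇒AllPairs : ∀ {P : Pred A p} {R : Rel A r} → (∀ {x y} → P x → P y → R x y) →
                 ∀ {xs} → All P xs → AllPairs R xs
  All⇒AllPairs R-of-P []         = []
  All⇒AllPairs R-of-P (px ∷ pxs) = All.map (R-of-P px) pxs ∷ All⇒AllPairs R-of-P pxs

  AllPairs-resp-⊆ : ∀ {R : Rel A r} → (AllPairs R) Respects _⊇_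
  AllPairs-resp-⊆ []         []        = []
  AllPairs-resp-⊆ (_ ∷ʳ τ)   (_ ∷ rs)  = AllPairs-resp-⊆ τ rs
  AllPairs-resp-⊆ (refl ∷ τ) (rx ∷ rs) = All-resp-⊆ τ rx ∷ AllPairs-resp-⊆ τ rs

  ¬¬-decidableOn : ∀ (R : Rel A r) L → ¬ ¬ All (λ x → All (λ y → Dec (R x y)) L) L
  ¬¬-decidableOn R L = All.sequenceM _ ¬¬-Monad
    (All.tabulate λ _ → All.sequenceM _ ¬¬-Monad (All.tabulate λ _ → ¬¬-excluded-middle))

  ⊆⇒All∈ : ∀ {xs ys : List A} → xs ⊆ ys → All (_∈ ys) xs
  ⊆⇒All∈ xs⊆ys = All.tabulate (lookup xs⊆ys)

  length-filter-∁ : ∀ {P : Pred A p} (P? : Decidableᵘ P) xs →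
                    length xs ≡ length (filter (∁? P?) xs) + length (filter P? xs)
  length-filter-∁ P? []       = refl
  length-filter-∁ P? (x ∷ xs) with P? x
  ... | yes _ = trans (cong suc (length-filter-∁ P? xs)) (sym (+-suc _ _))
  ... | no  _ = cong suc (length-filter-∁ P? xs)

  ⊆-insert : ∀ {x} {xs ys : List A} → xs ⊆ ys → x ∈ ys → x ∉ xs →
             ∃[ zs ] (zs ⊆ ys × zs ↭ x ∷ xs)
  ⊆-insert (y ∷ʳ τ) (here refl) _ = _ , refl ∷ τ , ↭-refl
  ⊆-insert (y ∷ʳ τ) (there x∈) x∉ with ⊆-insert τ x∈ x∉
  ... | zs , σ , zs↭ = zs , y ∷ʳ σ , zs↭
  ⊆-insert (refl ∷ τ) (here refl) x∉ = contradiction (here refl) x∉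
  ⊆-insert (refl ∷ τ) (there x∈) x∉ with ⊆-insert τ x∈ (x∉ ∘ there)
  ... | zs , σ , zs↭ = _ , refl ∷ σ , ↭-trans (↭-prep _ zs↭) (↭-swap _ _ ↭-refl)

module _ {A : Set} (_⊏_ : Rel A r) where

  Comparable : Rel A r
  Comparable x y = x ⊏ y ⊎ y ⊏ x

  IsChain : Pred (List A) r
  IsChain = AllPairs Comparable

  IsAntichain : Pred (List A) r
  IsAntichain = AllPairs (λ x y → ¬ Comparable x y)

module Mirsky {A : Set} {_⊏_ : Rel A r} (_⊏?_ : Decidable _⊏_) (⊏-trans : Transitive _⊏_)
               (rank : A → ℕ) (rank-mono : _⊏_ ⇒ (_<_ on rank)) where

  open import Data.List.Relation.Binary.Permutation.Setoid.Properties (setoid A)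
    using (AllPairs-resp-↭)

  ≼-⊏-trans : ∀ {x y z} → ReflClosure _⊏_ x y → y ⊏ z → x ⊏ z
  ≼-⊏-trans refl    y⊏z = y⊏z
  ≼-⊏-trans [ x⊏y ] y⊏z = ⊏-trans x⊏y y⊏z

  BelowSomeOf : List A → Pred A r
  BelowSomeOf L x = Any (x ⊏_) L

  belowSomeOf? : ∀ L → Decidableᵘ (BelowSomeOf L)
  belowSomeOf? L x = any? (x ⊏?_) L

  maximals : List A → List A
  maximals L = filter (∁? (belowSomeOf? L)) L

  nonMaximals : List A → List A
  nonMaximals L = filter (belowSomeOf? L) L

  ∈-nonMaximals⁻ : ∀ {L x} → x ∈ nonMaximals L → BelowSomeOf L x
  ∈-nonMaximals⁻ {L} = proj₂ ∘ ∈-filter⁻ (belowSomeOf? L) {xs = L}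

  maximals-antichain : ∀ L → IsAntichain _⊏_ (maximals L)
  maximals-antichain L = All⇒AllPairs incomparable
    (All.zip (all-filter (∁? (belowSomeOf? L)) L , ⊆⇒All∈ (filter-⊆ _ L)))
    where
    incomparable : ∀ {x y} → ¬ BelowSomeOf L x × x ∈ L → ¬ BelowSomeOf L y × y ∈ L →
                   ¬ Comparable _⊏_ x y
    incomparable (x-max , _) (_ , y∈) (inj₁ x⊏y) = x-max (lose y∈ x⊏y)
    incomparable (_ , x∈) (y-max , _) (inj₂ y⊏x) = y-max (lose x∈ y⊏x)

  -- A rank-maximal element above t is maximal, because ⊏ strictly increases rank.
  maximal-above : ∀ {L t v} → v ∈ L → t ⊏ v → ∃[ u ] (u ∈ L × t ⊏ u × ¬ BelowSomeOf L u)
  maximal-above {L} {t} {v} v∈ t⊏v = u , u∈ , t⊏u , u-max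
    where
    above = filter (t ⊏?_) L
    u = argmax rank v above
    u∈×t⊏u : u ∈ L × t ⊏ u
    u∈×t⊏u = argmax-all rank (v∈ , t⊏v) (All.tabulate (∈-filter⁻ (t ⊏?_) {xs = L}))
    u∈ = proj₁ u∈×t⊏u
    t⊏u = proj₂ u∈×t⊏u
    u-max : ¬ BelowSomeOf L u
    u-max u-below with find u-below
    ... | w , w∈ , u⊏w = <⇒≱ (rank-mono u⊏w)
      (All.lookup (f[xs]≤f[argmax] {f = rank} v above) (∈-filter⁺ (t ⊏?_) w∈ (⊏-trans t⊏u u⊏w)))

  chain-top : ∀ {x xs} → IsChain _⊏_ (x ∷ xs) →
              ∃[ t ] (t ∈ x ∷ xs × All (λ y → ReflClosure _⊏_ y t) (x ∷ xs))
  chain-top {x} {[]} _ = x , here refl , refl ∷ []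
  chain-top {x} {_ ∷ _} (x~xs ∷ c) with chain-top c
  ... | t , t∈ , xs≼t with All.lookup x~xs t∈
  ...   | inj₁ x⊏t = t , there t∈ , [ x⊏t ] ∷ xs≼t
  ...   | inj₂ t⊏x = x , here refl , refl ∷ All.map (λ y≼t → [ ≼-⊏-trans y≼t t⊏x ]) xs≼t

  -- The top of a chain of non-maximal elements lies below a maximal element,
  -- which extends the chain.
  chain-extend : ∀ L {x xs} → x ∷ xs ⊆ nonMaximals L → IsChain _⊏_ (x ∷ xs) →
                 ∃[ S ] (S ⊆ L × IsChain _⊏_ S × length S ≡ suc (length (x ∷ xs)))
  chain-extend L τ c =
    let t , t∈ , S≼t = chain-top c
        w , w∈ , t⊏w = find (∈-nonMaximals⁻ (lookup τ t∈))
        u , u∈ , t⊏u , u-max = maximal-above w∈ t⊏w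
        S′ , σ , S′↭ = ⊆-insert (⊆-trans τ (filter-⊆ _ L)) u∈ (u-max ∘ ∈-nonMaximals⁻ ∘ lookup τ)
        u∷S-chain = All.map (λ y≼t → inj₂ (≼-⊏-trans y≼t t⊏u)) S≼t ∷ c
    in S′ , σ , AllPairs-resp-↭ Sum.swap (resp₂ _) (↭⇒↭ₛ (↭-sym S′↭)) u∷S-chain , ↭-length S′↭

  mirsky : ∀ h w L → (∀ {S} → S ⊆ L → IsChain _⊏_ S → length S ≤ h) →
           (∀ {S} → S ⊆ L → IsAntichain _⊏_ S → length S ≤ w) → length L ≤ h * w
  mirsky zero    w []      _       _           = z≤n
  mirsky zero    w (_ ∷ L) chains≤ _           =
    contradiction (chains≤ (refl ∷ minimum L) ([] ∷ [])) λ ()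
  mirsky (suc h) w L       chains≤ antichains≤ = begin
    length L                                     ≡⟨ length-filter-∁ (belowSomeOf? L) L ⟩
    length (maximals L) + length (nonMaximals L) ≤⟨ +-mono-≤ maximals≤ nonMaximals≤ ⟩
    w + h * w                                    ∎
    where
    open ≤-Reasoning
    maximals≤ : length (maximals L) ≤ w
    maximals≤ = antichains≤ (filter-⊆ _ L) (maximals-antichain L)
    nonMaximal-chains≤ : ∀ {S} → S ⊆ nonMaximals L → IsChain _⊏_ S → length S ≤ h
    nonMaximal-chains≤ {[]}    _ _ = z≤n
    nonMaximal-chains≤ {_ ∷ _} τ c with chain-extend L τ c
    ... | S′ , σ , c′ , len = s≤s⁻¹ (subst (_≤ suc h) len (chains≤ σ c′))
    nonMaximals≤ : length (nonMaximals L) ≤ h * w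
    nonMaximals≤ = mirsky h w (nonMaximals L) nonMaximal-chains≤
                     (antichains≤ ∘ (λ τ → ⊆-trans τ (filter-⊆ _ L)))

minE-∈ : ∀ {r e} .{{_ : NonZero r}} → IsEdge r e → minE e ∈ e
minE-∈ {r} {[]}    (_ , 0≡r) = contradiction (sym 0≡r) (≢-nonZero⁻¹ r)
minE-∈ {r} {_ ∷ _} _         = here refl

module CliqueOrder {r} .{{_ : NonZero r}} {Q : PatternSet} {N : List Edge}
  (N-edges : All (IsEdge r) N) (N-disjoint : AllPairs Disjoint N) {_≺_ : Rel Edge 0ℓ}
  (≺⇔ : ∀ {e f} → e ∈ N → f ∈ N → (e ≺ f ⇔ (minE e < minE f × Forms Q e f))) where

  open Equivalence

  _≺ᴺ_ : Rel Edge 0ℓ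
  e ≺ᴺ f = e ∈ N × f ∈ N × e ≺ f

  ≺ᴺ-minE : _≺ᴺ_ ⇒ (_<_ on minE)
  ≺ᴺ-minE (e∈ , f∈ , e≺f) = proj₁ (to (≺⇔ e∈ f∈) e≺f)

  ≺ᴺ-Forms : ∀ {e f} → e ≺ᴺ f → Forms Q e f
  ≺ᴺ-Forms (e∈ , f∈ , e≺f) = proj₂ (to (≺⇔ e∈ f∈) e≺f)

  ≺ᴺ-trans : (∀ {e f g} → e ∈ N → f ∈ N → g ∈ N → e ≺ f → f ≺ g → e ≺ g) → Transitive _≺ᴺ_
  ≺ᴺ-trans ≺-trans (e∈ , f∈ , e≺f) (_ , g∈ , f≺g) = e∈ , g∈ , ≺-trans e∈ f∈ g∈ e≺f f≺g

  ≺ᴺ? : All (λ e → All (λ f → Dec (e ≺ f)) N) N → Decidable _≺ᴺ_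
  ≺ᴺ? ≺? e f with e ∈? N | f ∈? N
  ... | no e∉  | _      = no (e∉ ∘ proj₁)
  ... | yes _  | no f∉  = no (f∉ ∘ proj₁ ∘ proj₂)
  ... | yes e∈ | yes f∈ with All.lookup (All.lookup ≺? e∈) f∈
  ...   | yes e≺f = yes (e∈ , f∈ , e≺f)
  ...   | no e⊀f  = no (e⊀f ∘ proj₂ ∘ proj₂)

  comparable⇒Forms : ∀ {e f} → Disjoint e f → Comparable _≺ᴺ_ e f → Forms Q e f
  comparable⇒Forms _ (inj₁ e≺f) = ≺ᴺ-Forms e≺f
  comparable⇒Forms d (inj₂ f≺e) = subst Q (pat-swap d) (≺ᴺ-Forms f≺e)

  incomparable⇒¬Forms : ∀ {e f} → e ∈ N → f ∈ N → Disjoint e f →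
                        ¬ Comparable _≺ᴺ_ e f → ¬ Forms Q e f
  incomparable⇒¬Forms {e} {f} e∈ f∈ d e≁f q with <-cmp (minE e) (minE f)
  ... | tri< e<f _ _ = e≁f (inj₁ (e∈ , f∈ , from (≺⇔ e∈ f∈) (e<f , q)))
  ... | tri≈ _ e≡f _ =
    d (minE-∈ (All.lookup N-edges e∈) , subst (_∈ f) (sym e≡f) (minE-∈ (All.lookup N-edges f∈)))
  ... | tri> _ _ f<e =
    e≁f (inj₂ (f∈ , e∈ , from (≺⇔ f∈ e∈) (f<e , subst Q (sym (pat-swap d)) q)))

  chain⇒clique : ∀ {S} → S ⊆ N → IsChain _≺ᴺ_ S → IsClique Q S
  chain⇒clique τ c =
    AllPairs.zipWith {R = Disjoint} (λ (d , e~f) → comparable⇒Forms d e~f)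
      (AllPairs-resp-⊆ τ N-disjoint , c)

  antichain⇒clique : ∀ {P S} → S ⊆ N → IsClique P S → IsAntichain _≺ᴺ_ S → IsClique (P ∖ₚ Q) S
  antichain⇒clique τ P-clique a = AllPairs.zipWith
    (λ ((e∈ , f∈) , d , Pef , e≁f) → Pef , incomparable⇒¬Forms e∈ f∈ d e≁f)
    (All⇒AllPairs _,_ (⊆⇒All∈ τ) ,
     AllPairs.zip (AllPairs-resp-⊆ τ N-disjoint , AllPairs.zip (P-clique , a)))

lemma5p2 : (r : ℕ) → .{{_ : NonZero r}} → (P Q : PatternSet) → (M N : List Edge) →
    IsMatching r M → SubMatching N M → IsClique P N → Q ⊆ₚ P →
    (_≺_ : Edge → Edge → Set) → IsStrictPartialOrderOn _≺_ N →
    (∀ {e f} → e ∈ N → f ∈ N → (e ≺ f ⇔ (minE e < minE f × Forms Q e f))) →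
    (zQ zQc : ℕ) → IsZ Q M zQ → IsZ (P ∖ₚ Q) M zQc →
    length N ≤ zQc * zQ
lemma5p2 r P Q M N (M-edges , M-disjoint) N⊆M N-clique _ _≺_ (_ , ≺-trans) ≺⇔
         zQ zQc (_ , Q-cliques≤) (_ , Qᶜ-cliques≤) =
  -- ≺ need not be decidable, but the conclusion is, so deciding ≺ on N is free.
  decidable-stable (length N ≤? zQc * zQ) (¬¬-map bound (¬¬-decidableOn _≺_ N))
  where
  open CliqueOrder {Q = Q} (All-resp-⊆ N⊆M M-edges) (AllPairs-resp-⊆ N⊆M M-disjoint) ≺⇔
  bound : All (λ e → All (λ f → Dec (e ≺ f)) N) N → length N ≤ zQc * zQ
  bound ≺? = subst (length N ≤_) (*-comm zQ zQc) (mirsky zQ zQc N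
    (λ τ c → Q-cliques≤ _ (⊆-trans τ N⊆M) (chain⇒clique τ c))
    (λ τ a → Qᶜ-cliques≤ _ (⊆-trans τ N⊆M)
               (antichain⇒clique {P = P} τ (AllPairs-resp-⊆ τ N-clique) a)))
    where open Mirsky (≺ᴺ? ≺?) (≺ᴺ-trans ≺-trans) minE ≺ᴺ-minE
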